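{- Let $F=(V,E)$ be a Fitch graph, and let $G$ be the digraph obtained from $F$ by removing all bi-directional edges, i.e., removing both $(x,y)$ and $(y,x)$ from $E$ whenever both belong to $E$. Then $G$ is a directed acyclic graph (DAG).
   Context: All digraphs are finite and have irreflexive edge sets. A rooted tree is a finite directed tree with all edges directed away from a unique root $\rho_T$, in which no non-root vertex has exactly one child; $L(T)$ denotes its leaf set, and $\mathrm{lca}_T(x,y)$ the least common ancestor of $x,y$. A digraph $G=(V,E)$ is a Fitch graph if it is isomorphic to a digraph $\mathbb{G}(T,\lambda)$, where $T$ is a rooted tree with leaf set $V$, $\lambda\colon E(T)\to\{0,1\}$ is an edge-labeling, and $\mathbb{G}(T,\lambda)$ has vertex set $V$ and contains the edge $(x,y)$, for distinct $x,y\in V$, if and only if the unique path in $T$ from $\mathrm{lca}_T(x,y)$ to $y$ contains at least one edge $e$ with $\lambda(e)=1$. A DAG is a digraph containing no directed cycle. -}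

module Defs where

open import Data.Nat using (ℕ; _≤_)
open import Data.Bool using (Bool; true; false)
open import Data.Fin using (Fin)
open import Data.Product using (Σ; _×_; _,_; proj₂; ∃)
open import Data.Sum using (_⊎_)
open import Data.List using (List; []; _∷_; _++_; _∷ʳ_; length)
open import Data.List.Membership.Propositional using (_∈_)
open import Data.List.Relation.Unary.All using (All)
open import Data.List.Relation.Unary.Unique.Propositional using (Unique)
open import Data.List.Relation.Unary.Linked using (Linked)
open import Relation.Nullary using (¬_)
open import Relation.Binary.PropositionalEquality using (_≡_)
open import Function.Bundles using (_⤖_; Bijection)

Digraph : ℕ → Set₁
Digraph n = Fin n → Fin n → Set

-- A tree is either a leaf (labelled by a vertex) or an inner vertex with
-- a list of children; each child comes with the label λ(e) ∈ {0,1}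
-- (false = 0, true = 1) of the edge from the inner vertex to that child.

data Tree (n : ℕ) : Set where
  leaf : Fin n → Tree n
  node : List (Bool × Tree n) → Tree n

mutual
  leaves : ∀ {n} → Tree n → List (Fin n)
  leaves (leaf x)  = x ∷ []
  leaves (node cs) = leavesL cs

  leavesL : ∀ {n} → List (Bool × Tree n) → List (Fin n)
  leavesL []             = []
  leavesL ((_ , t) ∷ cs) = leaves t ++ leavesL cs

data NonRootOK {n : ℕ} : Tree n → Set where
  leafOK : ∀ x → NonRootOK (leaf x)
  nodeOK : ∀ cs → 2 ≤ length cs → All (λ c → NonRootOK (proj₂ c)) cs →
           NonRootOK (node cs)

data RootedTree {n : ℕ} : Tree n → Set where
  rootLeaf : ∀ x → RootedTree (leaf x)
  rootNode : ∀ cs → 1 ≤ length cs → All (λ c → NonRootOK (proj₂ c)) cs →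
             RootedTree (node cs)

LeafSetIsV : ∀ {n} → Tree n → Set
LeafSetIsV {n} t = Unique (leaves t) × (∀ (x : Fin n) → x ∈ leaves t)

-- HasOne t y : the path from the root of t to the leaf y contains an edge
-- labelled 1.
data HasOne {n : ℕ} : Tree n → Fin n → Set where
  here  : ∀ {cs c y} → (true , c) ∈ cs → y ∈ leaves c → HasOne (node cs) y
  there : ∀ {cs b c y} → (b , c) ∈ cs → HasOne c y → HasOne (node cs) y

-- LcaPathHasOne t x y (for leaves x, y of t): the path from lca_t(x,y) to y
-- contains an edge labelled 1.  Either x and y lie below a common child
-- (then lca is inside that child), or y lies below a child c not containing
-- x, in which case lca is the current vertex and the path to y is the edge
-- to c followed by the path from c to y.
data LcaPathHasOne {n : ℕ} : Tree n → Fin n → Fin n → Set where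
  same  : ∀ {cs b c x y} → (b , c) ∈ cs → x ∈ leaves c → y ∈ leaves c →
          LcaPathHasOne c x y → LcaPathHasOne (node cs) x y
  split : ∀ {cs b c x y} → (b , c) ∈ cs → y ∈ leaves c → ¬ (x ∈ leaves c) →
          (b ≡ true ⊎ HasOne c y) → LcaPathHasOne (node cs) x y

FitchOf : ∀ {n} → Tree n → Digraph n
FitchOf t x y = ¬ (x ≡ y) × LcaPathHasOne t x y

IsFitch : ∀ {n} → Digraph n → Set
IsFitch {n} E =
  Σ (Tree n) λ T → RootedTree T × LeafSetIsV T ×
  Σ (Fin n ⤖ Fin n) λ σ →
    ∀ x y → (E x y → FitchOf T (Bijection.to σ x) (Bijection.to σ y))
          × (FitchOf T (Bijection.to σ x) (Bijection.to σ y) → E x y)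

RemoveBidir : ∀ {n} → Digraph n → Digraph n
RemoveBidir E x y = E x y × ¬ E y x

DirectedCycle : ∀ {n} → Digraph n → Set
DirectedCycle {n} E =
  Σ (Fin n) λ v → Σ (List (Fin n)) λ vs →
    Unique (v ∷ vs) × Linked E ((v ∷ vs) ∷ʳ v)

IsDAG : ∀ {n} → Digraph n → Set
IsDAG E = ¬ DirectedCycle E

{-# OPTIONS --safe #-}
module Submission where

-- Let the potential of a leaf z be the depth of the lowest 1-edge on the path from the
-- root to z (0 if there is none).  If (x,y) is a one-way Fitch edge, the path from
-- lca(x,y) to y carries a 1-edge while the path from lca(x,y) to x does not, so the
-- potential of x is at most the depth of the lca and that of y exceeds it.  The
-- potential therefore strictly increases along every edge of G, and G has no cycle.

open import Defs
open import Data.Nat using (ℕ; zero; suc; _<_; z≤n; s≤s)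
open import Data.Nat.Properties using (<-trans; <-irrefl)
open import Data.Bool using (Bool; true; false)
open import Data.Fin using (Fin)
open import Data.Fin.Properties using (_≟_)
open import Data.Product using (_×_; _,_; proj₁; proj₂)
open import Data.Sum using (_⊎_; inj₁; inj₂)
import Data.Sum as Sum
open import Data.Empty using (⊥-elim)
open import Data.List using (List; []; _∷_; _++_; _∷ʳ_)
open import Data.List.Membership.Propositional using (_∈_; _∉_)
open import Data.List.Membership.Propositional.Properties using (∈-++⁺ˡ; ∈-++⁺ʳ)
open import Data.List.Relation.Unary.Any using (here; there)
open import Data.List.Relation.Unary.All as All using ()
open import Data.List.Relation.Unary.All.Properties using (++⁻ˡ; ++⁻ʳ)
open import Data.List.Relation.Unary.AllPairs using (_∷_)
open import Data.List.Relation.Unary.Unique.Propositional using (Unique; [])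
open import Data.List.Relation.Unary.Linked using (Linked; [-]; _∷_)
open import Relation.Nullary using (¬_; yes; no)
open import Relation.Binary.Core using (Rel)
open import Relation.Binary.PropositionalEquality using (_≡_; refl; sym; subst)
open import Function.Bundles using (Bijection)

module _ {a} {A : Set a} where

  Unique-++⁻ˡ : ∀ xs {ys : List A} → Unique (xs ++ ys) → Unique xs
  Unique-++⁻ˡ []       _       = []
  Unique-++⁻ˡ (x ∷ xs) (p ∷ u) = ++⁻ˡ xs p ∷ Unique-++⁻ˡ xs u

  Unique-++⁻ʳ : ∀ xs {ys : List A} → Unique (xs ++ ys) → Unique ys
  Unique-++⁻ʳ []       u       = u
  Unique-++⁻ʳ (x ∷ xs) (_ ∷ u) = Unique-++⁻ʳ xs u

  Unique-++⇒disjoint : ∀ xs {ys : List A} {z} → Unique (xs ++ ys) → z ∈ xs → z ∉ ys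
  Unique-++⇒disjoint (x ∷ xs) (p ∷ _) (here refl) z∈ys = All.lookup (++⁻ʳ xs p) z∈ys refl
  Unique-++⇒disjoint (x ∷ xs) (_ ∷ u) (there z∈xs) = Unique-++⇒disjoint xs u z∈xs

module _ {a ℓ} {A : Set a} {R : Rel A ℓ} (f : A → ℕ) (increasing : ∀ {x y} → R x y → f x < f y) where

  Linked⇒<-first-last : ∀ x xs y → Linked R (x ∷ xs ∷ʳ y) → f x < f y
  Linked⇒<-first-last x []       y (r ∷ [-])   = increasing r
  Linked⇒<-first-last x (z ∷ xs) y (r ∷ rest) = <-trans (increasing r) (Linked⇒<-first-last z xs y rest)

  Linked-cycle-free : ∀ x xs → ¬ Linked R (x ∷ xs ∷ʳ x)
  Linked-cycle-free x xs cycle = <-irrefl refl (Linked⇒<-first-last x xs x cycle)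

module _ {n : ℕ} where

  open import Data.List.Membership.DecPropositional (_≟_ {n}) using (_∈?_)

  Children : Set
  Children = List (Bool × Tree n)

  ∈-leavesL⁺ : ∀ {cs : Children} {b c z} → (b , c) ∈ cs → z ∈ leaves c → z ∈ leavesL cs
  ∈-leavesL⁺ (here refl) z∈c = ∈-++⁺ˡ z∈c
  ∈-leavesL⁺ {(_ , d) ∷ _} (there p) z∈c = ∈-++⁺ʳ (leaves d) (∈-leavesL⁺ p z∈c)

  HasOne⇒∈-leaves : ∀ {t : Tree n} {z} → HasOne t z → z ∈ leaves t
  HasOne⇒∈-leaves (here p z∈c)  = ∈-leavesL⁺ p z∈c
  HasOne⇒∈-leaves (there p one) = ∈-leavesL⁺ p (HasOne⇒∈-leaves one)

  Unique-child : ∀ {cs : Children} {b c} → Unique (leavesL cs) → (b , c) ∈ cs → Unique (leaves c)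
  Unique-child {(_ , d) ∷ _} u (here refl) = Unique-++⁻ˡ (leaves d) u
  Unique-child {(_ , d) ∷ _} u (there p)   = Unique-child (Unique-++⁻ʳ (leaves d) u) p

  child-determined-by-leaf : ∀ {cs : Children} {b c b′ c′ z} → Unique (leavesL cs) →
    (b , c) ∈ cs → (b′ , c′) ∈ cs → z ∈ leaves c → z ∈ leaves c′ → (b , c) ≡ (b′ , c′)
  child-determined-by-leaf u (here refl) (here refl) _ _ = refl
  child-determined-by-leaf {(_ , d) ∷ _} u (here refl) (there q) z∈d z∈c′ =
    ⊥-elim (Unique-++⇒disjoint (leaves d) u z∈d (∈-leavesL⁺ q z∈c′))
  child-determined-by-leaf {(_ , d) ∷ _} u (there p) (here refl) z∈c z∈d =
    ⊥-elim (Unique-++⇒disjoint (leaves d) u z∈d (∈-leavesL⁺ p z∈c))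
  child-determined-by-leaf {(_ , d) ∷ _} u (there p) (there q) z∈c z∈c′ =
    child-determined-by-leaf (Unique-++⁻ʳ (leaves d) u) p q z∈c z∈c′

  -- The potential seen from the parent of an edge labelled b, given the potential k seen
  -- from its child: a 1-edge below (k > 0) is one level deeper, otherwise the edge itself
  -- is the lowest 1-edge exactly when b = true.
  extendUp : Bool → ℕ → ℕ
  extendUp _     (suc k) = suc (suc k)
  extendUp true  zero    = 1
  extendUp false zero    = 0

  extendUp-pos⁻ : ∀ b k → 0 < extendUp b k → b ≡ true ⊎ 0 < k
  extendUp-pos⁻ _    (suc k) _ = inj₂ (s≤s z≤n)
  extendUp-pos⁻ true zero    _ = inj₁ refl

  extendUp-pos⁺ : ∀ b k → b ≡ true ⊎ 0 < k → 0 < extendUp b k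
  extendUp-pos⁺ _     (suc k) _         = s≤s z≤n
  extendUp-pos⁺ true  zero    _         = s≤s z≤n
  extendUp-pos⁺ false zero    (inj₁ ())
  extendUp-pos⁺ false zero    (inj₂ ())

  extendUp-mono-< : ∀ b {k k′} → k < k′ → extendUp b k < extendUp b k′
  extendUp-mono-< _     {suc _} {suc _} k<k′ = s≤s k<k′
  extendUp-mono-< true  {zero}  {suc _} _    = s≤s (s≤s z≤n)
  extendUp-mono-< false {zero}  {suc _} _    = s≤s z≤n

  mutual
    lowestOneDepth : Tree n → Fin n → ℕ
    lowestOneDepth (leaf _)  z = 0
    lowestOneDepth (node cs) z = lowestOneDepthL cs z

    lowestOneDepthL : Children → Fin n → ℕ
    lowestOneDepthL []             z = 0
    lowestOneDepthL ((b , c) ∷ cs) z with z ∈? leaves c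
    ... | yes _ = extendUp b (lowestOneDepth c z)
    ... | no  _ = lowestOneDepthL cs z

  lowestOneDepthL-child : ∀ {cs : Children} {b c z} → Unique (leavesL cs) →
    (b , c) ∈ cs → z ∈ leaves c → lowestOneDepthL cs z ≡ extendUp b (lowestOneDepth c z)
  lowestOneDepthL-child {(_ , c) ∷ _} {z = z} u (here refl) z∈c with z ∈? leaves c
  ... | yes _   = refl
  ... | no  z∉c = ⊥-elim (z∉c z∈c)
  lowestOneDepthL-child {(_ , d) ∷ _} {z = z} u (there p) z∈c with z ∈? leaves d
  ... | yes z∈d = ⊥-elim (Unique-++⇒disjoint (leaves d) u z∈d (∈-leavesL⁺ p z∈c))
  ... | no  _   = lowestOneDepthL-child (Unique-++⁻ʳ (leaves d) u) p z∈c

  mutual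
    lowestOneDepth-pos⇒HasOne : ∀ (t : Tree n) z → 0 < lowestOneDepth t z → HasOne t z
    lowestOneDepth-pos⇒HasOne (node cs) z pos = lowestOneDepthL-pos⇒HasOne cs z pos

    lowestOneDepthL-pos⇒HasOne : ∀ (cs : Children) z → 0 < lowestOneDepthL cs z → HasOne (node cs) z
    lowestOneDepthL-pos⇒HasOne ((b , c) ∷ cs) z pos with z ∈? leaves c
    ... | yes z∈c with extendUp-pos⁻ b (lowestOneDepth c z) pos
    ...   | inj₁ refl  = here (here refl) z∈c
    ...   | inj₂ c-pos = there (here refl) (lowestOneDepth-pos⇒HasOne c z c-pos)
    lowestOneDepthL-pos⇒HasOne ((b , c) ∷ cs) z pos | no _
      with lowestOneDepthL-pos⇒HasOne cs z pos
    ... | here p z∈c′  = here (there p) z∈c′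
    ... | there p one  = there (there p) one

  HasOne⇒lowestOneDepth-pos : ∀ (t : Tree n) {z} → Unique (leaves t) → HasOne t z → 0 < lowestOneDepth t z
  HasOne⇒lowestOneDepth-pos (node cs) {z} u (here {c = c} p z∈c) =
    subst (0 <_) (sym (lowestOneDepthL-child u p z∈c)) (extendUp-pos⁺ true (lowestOneDepth c z) (inj₁ refl))
  HasOne⇒lowestOneDepth-pos (node cs) {z} u (there {b = b} {c = c} p one) =
    subst (0 <_) (sym (lowestOneDepthL-child u p (HasOne⇒∈-leaves one)))
      (extendUp-pos⁺ b (lowestOneDepth c z) (inj₂ (HasOne⇒lowestOneDepth-pos c (Unique-child u p) one)))

  ¬HasOne⇒lowestOneDepthL≡0 : ∀ (cs : Children) z → ¬ HasOne (node cs) z → lowestOneDepthL cs z ≡ 0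
  ¬HasOne⇒lowestOneDepthL≡0 cs z ¬one with lowestOneDepthL cs z | lowestOneDepthL-pos⇒HasOne cs z
  ... | zero  | _       = refl
  ... | suc _ | pos⇒one = ⊥-elim (¬one (pos⇒one (s≤s z≤n)))

  split-irreversible⇒¬HasOne : ∀ {cs : Children} {b c x y} → Unique (leavesL cs) →
    (b , c) ∈ cs → y ∈ leaves c → x ∉ leaves c → ¬ LcaPathHasOne (node cs) y x → ¬ HasOne (node cs) x
  split-irreversible⇒¬HasOne {cs} {x = x} {y} u p y∈c x∉c ¬yx = ¬x-one
    where
      split-yx : ∀ {b′ c′} → (b′ , c′) ∈ cs → x ∈ leaves c′ → b′ ≡ true ⊎ HasOne c′ x → LcaPathHasOne (node cs) y x
      split-yx q x∈c′ = split q x∈c′ λ y∈c′ →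
        x∉c (subst (λ d → x ∈ leaves (proj₂ d)) (sym (child-determined-by-leaf u p q y∈c y∈c′)) x∈c′)

      ¬x-one : ¬ HasOne (node cs) x
      ¬x-one (here  q x∈c′)  = ¬yx (split-yx q x∈c′ (inj₁ refl))
      ¬x-one (there q x-one) = ¬yx (split-yx q (HasOne⇒∈-leaves x-one) (inj₂ x-one))

  oneWay⇒lowestOneDepth-< : ∀ (t : Tree n) {x y} → Unique (leaves t) →
    LcaPathHasOne t x y → ¬ LcaPathHasOne t y x → lowestOneDepth t x < lowestOneDepth t y
  oneWay⇒lowestOneDepth-< (node cs) u (same {b = b} {c = c} p x∈c y∈c xy) ¬yx
    rewrite lowestOneDepthL-child u p x∈c | lowestOneDepthL-child u p y∈c =
    extendUp-mono-< b (oneWay⇒lowestOneDepth-< c (Unique-child u p) xy (λ yx → ¬yx (same p y∈c x∈c yx)))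
  oneWay⇒lowestOneDepth-< (node cs) {x} {y} u (split {b = b} {c = c} p y∈c x∉c one) ¬yx
    rewrite ¬HasOne⇒lowestOneDepthL≡0 cs x (split-irreversible⇒¬HasOne u p y∈c x∉c ¬yx)
          | lowestOneDepthL-child u p y∈c =
    extendUp-pos⁺ b (lowestOneDepth c y) (Sum.map₂ (HasOne⇒lowestOneDepth-pos c (Unique-child u p)) one)

lemma1 : ∀ {n : ℕ} (F : Digraph n) → IsFitch F → IsDAG (RemoveBidir F)
lemma1 {n} F (T , _ , (unique , _) , σ , F⇔) (v , vs , _ , cycle) =
  Linked-cycle-free potential increasing v vs cycle
  where
    open Bijection σ using (to)

    potential : Fin n → ℕ
    potential x = lowestOneDepth T (to x)

    increasing : ∀ {x y} → RemoveBidir F x y → potential x < potential y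
    increasing {x} {y} (Fxy , ¬Fyx) with proj₁ (F⇔ x y) Fxy
    ... | x≢y , xy = oneWay⇒lowestOneDepth-< T unique xy
                       (λ yx → ¬Fyx (proj₂ (F⇔ y x) ((λ y≡x → x≢y (sym y≡x)) , yx)))
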